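{- Let $s\ge1$, $t\ge 2$, $G\in\mathcal{G}_{s,t}$ with root $r$, and let $C$ be a boundary configuration on $G$ with $k$ pebble-free vertices in $S$. If there exists a pebbled vertex $v\in S$ such that all neighbors of $v$ in $S$ are pebbled, then Mover has a winning strategy.
   Context: A configuration $C$ on a graph $G$ is a function $C:V(G)\to\mathbb{Z}_{\ge 0}$. A pebbling move removes two pebbles from a vertex and places one pebble on an adjacent vertex. The Two-Player Pebbling Game on $G$ with root $r$ and starting configuration $C$ is played by Mover and Defender in rounds: in each round Mover makes a pebbling move and then Defender makes a pebbling move; each player must take their turn. If Mover pebbles from $u$ to $v$, Defender may not pebble from $v$ to $u$ in the same round. Mover wins if at any time the root has at least one pebble; Defender wins if the root has no pebble and there are no more pebbling moves. A winning strategy is a rule choosing a player's moves as a function of the current position which guarantees that player wins. For integers $s,t\ge1$, $\mathcal{G}_{s,t}$ is the class of all graphs $(K_1\cup \overline{K_t})\vee H$, where $H$ is any graph on $s$ vertices, $\overline{K_t}$ is the edgeless graph on $t$ vertices, $\cup$ is disjoint union and $\vee$ is the join. The root $r$ is the vertex of $K_1$; $S=V(H)$, $T=V(\overline{K_t})$. A configuration is non-trivial if each vertex of $S$ has 0 or 1 pebbles and the root has no pebbles. A vertex is pebble-free if it has no pebbles, pebbled otherwise; it is even or odd according to the parity of $C(v)$. $k$ is the number of pebble-free vertices of $S$, and $C_T=\sum_{v\in T}\lfloor C(v)/2\rfloor$. For $t\ge2$, a boundary configuration is a non-trivial configuration with $k$ even and $C_T=k+2$ such that there is one even vertex $x\in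 T$ with $C(x)\ge 2$ and all other vertices of $T$ have an odd number of pebbles. -}

module Defs where

open import Data.Nat using (ℕ; zero; suc; _+_; _∸_; _≤_; _≥_; _/_)
open import Data.Nat.Divisibility using (_∣_)
open import Data.Fin using (Fin)
open import Data.Fin.Properties using () renaming (_≟_ to _≟F_)
open import Data.List using (List; length; filter; map; allFin)
open import Data.Nat.ListAction using (sum)
open import Data.Product using (Σ; ∃; _×_; _,_)
open import Data.Empty using (⊥)
open import Data.Unit using (⊤)
open import Relation.Nullary using (¬_; Dec; yes; no)
open import Relation.Binary using (Decidable)
open import Relation.Binary.PropositionalEquality using (_≡_; refl; cong)
import Data.Nat as ℕ

record SimpleGraph (s : ℕ) : Set₁ where
  field
    Adj     : Fin s → Fin s → Set
    adj?    : Decidable Adj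
    symm    : ∀ {i j} → Adj i j → Adj j i
    irrefl  : ∀ {i} → ¬ Adj i i
open SimpleGraph public

-- Vertices of G = (K₁ ∪ K̄_t) ∨ H : the root r, S = V(H) = Fin s,
-- T = V(K̄_t) = Fin t.

data Vtx (s t : ℕ) : Set where
  root : Vtx s t
  sv   : Fin s → Vtx s t
  tv   : Fin t → Vtx s t

Edge : ∀ {s t} → SimpleGraph s → Vtx s t → Vtx s t → Set
Edge H root   root   = ⊥
Edge H root   (sv j) = ⊤
Edge H root   (tv j) = ⊥
Edge H (sv i) root   = ⊤
Edge H (sv i) (sv j) = Adj H i j
Edge H (sv i) (tv j) = ⊤
Edge H (tv i) root   = ⊥
Edge H (tv i) (sv j) = ⊤
Edge H (tv i) (tv j) = ⊥

_≟V_ : ∀ {s t} → (u v : Vtx s t) → Dec (u ≡ v)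
root ≟V root = yes refl
root ≟V sv _ = no λ ()
root ≟V tv _ = no λ ()
sv _ ≟V root = no λ ()
sv i ≟V sv j with i ≟F j
... | yes refl = yes refl
... | no ne = no λ { refl → ne refl }
sv _ ≟V tv _ = no λ ()
tv _ ≟V root = no λ ()
tv _ ≟V sv _ = no λ ()
tv i ≟V tv j with i ≟F j
... | yes refl = yes refl
... | no ne = no λ { refl → ne refl }

Config : ℕ → ℕ → Set
Config s t = Vtx s t → ℕ

-- The configuration after the pebbling move u → v (remove two pebbles
-- from u, add one to v). Only used when u has ≥ 2 pebbles and u ≠ v.
step : ∀ {s t} → Config s t → Vtx s t → Vtx s t → Config s t
step C u v w with w ≟V u | w ≟V v
... | yes _ | _     = C w ∸ 2
... | no _  | yes _ = suc (C w)
... | no _  | no _  = C w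

LegalMove : ∀ {s t} → SimpleGraph s → Config s t → Vtx s t → Vtx s t → Set
LegalMove H C u v = Edge H u v × 2 ≤ C u

-- DefenderLoses H C u v : Defender is to move at C, Mover has just
--                   pebbled u → v (so Defender may not pebble v → u),
--                   and Mover has a winning strategy.
-- The game is finite (every move removes a pebble), so winning
-- positions are defined inductively (backward induction).  A player
-- with no legal move ends the game; Mover wins iff the root is pebbled.

mutual
  data MoverWins {s t} (H : SimpleGraph s) (C : Config s t) : Set where
    rootPebbled : 1 ≤ C root → MoverWins H C
    moverMove   : (u v : Vtx s t) → LegalMove H C u v →
                  DefenderLoses H (step C u v) u v → MoverWins H C

  data DefenderLoses {s t} (H : SimpleGraph s) (C : Config s t)
                     (u v : Vtx s t) : Set where
    rootPebbled : 1 ≤ C root → DefenderLoses H C u v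
    allReplies  :
      -- Defender has at least one legal move (otherwise the game ends
      -- with the root pebble-free, a Defender win) ...
      (Σ (Vtx s t) λ x → Σ (Vtx s t) λ y →
         LegalMove H C x y × ¬ (x ≡ v × y ≡ u)) →
      ((x y : Vtx s t) → LegalMove H C x y → ¬ (x ≡ v × y ≡ u) →
         MoverWins H (step C x y)) →
      DefenderLoses H C u v

Even Odd : ℕ → Set
Even n = 2 ∣ n
Odd n = ¬ (2 ∣ n)

NonTrivial : ∀ {s t} → Config s t → Set
NonTrivial {s} C = ((i : Fin s) → C (sv i) ≤ 1) × C root ≡ 0

pebbleFreeS : ∀ {s t} → Config s t → ℕ
pebbleFreeS {s} C = length (filter (λ i → C (sv i) ℕ.≟ 0) (allFin s))

C-T : ∀ {s t} → Config s t → ℕ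
C-T {s} {t} C = sum (map (λ j → C (tv j) / 2) (allFin t))

Boundary : ∀ {s t} → Config s t → Set
Boundary {s} {t} C =
  NonTrivial C × Even (pebbleFreeS C) × C-T C ≡ pebbleFreeS C + 2 ×
  Σ (Fin t) λ x → Even (C (tv x)) × 2 ≤ C (tv x) ×
    ((j : Fin t) → ¬ (j ≡ x) → Odd (C (tv j)))

module Submission where

-- Write k for the number of pebble-free S-vertices and C_T for the number of
-- pebble pairs on T.  The proof has two game-theoretic ingredients.
--
--  * Odd-deficit lemma: in a non-trivial configuration with k odd and
--    C_T ≥ k + 1, Mover wins.  Mover moves a pair from T onto a pebble-free
--    S-vertex (k and C_T both drop by one).  Defender can only move from T
--    to S: onto a pebbled vertex, which then holds two pebbles and Mover
--    reaches the root; or onto a pebble-free vertex, which restores the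
--    hypotheses with k two smaller (induction on k).
--  * Boundary analysis: Mover moves from the even T-vertex x onto v, which
--    now holds two pebbles.  Every Defender reply either leaves two pebbles
--    on some S-vertex (v itself, or a neighbour of v, all pebbled), reaches
--    the root, or moves v's two pebbles onto an odd T-vertex y ≠ x.  In the
--    last case v becomes pebble-free and y gains a pair, giving k odd with
--    C_T = k + 1: the odd-deficit lemma applies.

open import Defs
open import Data.Nat using (ℕ; zero; suc; _+_; _*_; _∸_; _/_; _≤_; z≤n; s≤s)
open import Data.Nat.Properties
open import Data.Nat.DivMod using (m/n≡1+[m∸n]/n; m/n≢0⇒n≤m)
open import Data.Nat.Divisibility using (divides; ∣m∣n⇒∣m+n; ∣-refl; _∣0)
open import Algebra.Properties.CommutativeSemigroup +-commutativeSemigroup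
  using (x∙yz≈y∙xz)
open import Data.Fin using (Fin; zero; suc) renaming (_≟_ to _≟F_)
open import Data.Fin.Properties using () renaming (suc-injective to Fin-suc-injective)
open import Data.List using (length; filter; tabulate)
open import Data.List.Properties using (tabulate-cong; map-tabulate)
open import Data.Nat.ListAction using (sum)
open import Data.Product using (Σ; _×_; _,_; proj₂)
open import Data.Empty using (⊥-elim)
open import Data.Unit using (tt)
open import Function using (_∘_; id)
open import Relation.Nullary using (¬_; yes; no)
open import Relation.Binary.PropositionalEquality

private
  variable
    s t : ℕ

step-source : (C : Config s t) (u v : Vtx s t) → step C u v u ≡ C u ∸ 2
step-source C u v with u ≟V u
... | yes _ = refl
... | no u≢u = ⊥-elim (u≢u refl)

step-target : (C : Config s t) (u v : Vtx s t) → ¬ u ≡ v → step C u v v ≡ suc (C v)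
step-target C u v u≢v with v ≟V u | v ≟V v
... | yes v≡u | _ = ⊥-elim (u≢v (sym v≡u))
... | no _ | yes _ = refl
... | no _ | no v≢v = ⊥-elim (v≢v refl)

step-other : (C : Config s t) (u v w : Vtx s t) → ¬ w ≡ u → ¬ w ≡ v →
             step C u v w ≡ C w
step-other C u v w w≢u w≢v with w ≟V u | w ≟V v
... | yes w≡u | _ = ⊥-elim (w≢u w≡u)
... | no _ | yes w≡v = ⊥-elim (w≢v w≡v)
... | no _ | no _ = refl

step-nonsource-≥ : (C : Config s t) (u v w : Vtx s t) → ¬ w ≡ u → C w ≤ step C u v w
step-nonsource-≥ C u v w w≢u with w ≟V u | w ≟V v
... | yes w≡u | _ = ⊥-elim (w≢u w≡u)
... | no _ | yes _ = n≤1+n _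
... | no _ | no _ = ≤-refl

sv-≢ : {i j : Fin s} → ¬ i ≡ j → ¬ sv {t = t} i ≡ sv j
sv-≢ i≢j refl = i≢j refl

tv-≢ : {i j : Fin t} → ¬ i ≡ j → ¬ tv {s = s} i ≡ tv j
tv-≢ i≢j refl = i≢j refl

ΣFin : {n : ℕ} → (Fin n → ℕ) → ℕ
ΣFin φ = sum (tabulate φ)

ΣFin-update : {n : ℕ} (φ ψ : Fin n → ℕ) (p : Fin n) (d : ℕ) →
              ψ p ≡ d + φ p → (∀ i → ¬ i ≡ p → ψ i ≡ φ i) →
              ΣFin ψ ≡ d + ΣFin φ
ΣFin-update φ ψ zero d ψp≡ agree = begin
  ψ zero + ΣFin (ψ ∘ suc)        ≡⟨ cong₂ _+_ ψp≡ (cong sum (tabulate-cong (λ i → agree (suc i) λ ()))) ⟩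
  (d + φ zero) + ΣFin (φ ∘ suc)  ≡⟨ +-assoc d (φ zero) _ ⟩
  d + ΣFin φ                     ∎
  where open ≡-Reasoning
ΣFin-update φ ψ (suc p) d ψp≡ agree = begin
  ψ zero + ΣFin (ψ ∘ suc)        ≡⟨ cong₂ _+_ (agree zero λ ()) rest ⟩
  φ zero + (d + ΣFin (φ ∘ suc))  ≡⟨ x∙yz≈y∙xz (φ zero) d _ ⟩
  d + ΣFin φ                     ∎
  where
  open ≡-Reasoning
  rest : ΣFin (ψ ∘ suc) ≡ d + ΣFin (φ ∘ suc)
  rest = ΣFin-update (φ ∘ suc) (ψ ∘ suc) p d ψp≡ λ i i≢p → agree (suc i) (i≢p ∘ Fin-suc-injective)

ΣFin-positive : {n : ℕ} (φ : Fin n → ℕ) → 1 ≤ ΣFin φ → Σ (Fin n) λ i → 1 ≤ φ i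
ΣFin-positive {suc n} φ pos with φ zero in eq
... | suc _ = zero , subst (1 ≤_) (sym eq) (s≤s z≤n)
... | zero = let (i , 1≤φi) = ΣFin-positive (φ ∘ suc) pos in suc i , 1≤φi

isZero : ℕ → ℕ
isZero zero = 1
isZero (suc _) = 0

isZero-positive : (n : ℕ) → 1 ≤ isZero n → n ≡ 0
isZero-positive zero _ = refl

emptyS : Config s t → ℕ
emptyS C = ΣFin (λ i → isZero (C (sv i)))

pairsT : Config s t → ℕ
pairsT C = ΣFin (λ j → C (tv j) / 2)

length-filter-zero : {A : Set} {n : ℕ} (F : A → ℕ) (h : Fin n → A) →
  length (filter (λ a → F a ≟ 0) (tabulate h)) ≡ ΣFin (λ i → isZero (F (h i)))
length-filter-zero {n = zero} F h = refl
length-filter-zero {n = suc n} F h with F (h zero)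
... | zero = cong suc (length-filter-zero F (h ∘ suc))
... | suc _ = length-filter-zero F (h ∘ suc)

pebbleFreeS≡emptyS : (C : Config s t) → pebbleFreeS C ≡ emptyS C
pebbleFreeS≡emptyS C = length-filter-zero (C ∘ sv) id

C-T≡pairsT : (C : Config s t) → C-T C ≡ pairsT C
C-T≡pairsT C = cong sum (map-tabulate id (λ j → C (tv j) / 2))

half-positive : (c : ℕ) → 1 ≤ c / 2 → 2 ≤ c
half-positive c 1≤c/2 = m/n≢0⇒n≤m (m<n⇒n≢0 1≤c/2)

half-suc-odd : (c : ℕ) → Odd c → suc c / 2 ≡ 1 + c / 2
half-suc-odd zero odd = ⊥-elim (odd (2 ∣0))
half-suc-odd (suc zero) odd = refl
half-suc-odd (suc (suc c)) odd = begin
  (3 + c) / 2     ≡⟨ m/n≡1+[m∸n]/n {3 + c} (s≤s (s≤s z≤n)) ⟩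
  1 + suc c / 2   ≡⟨ cong suc (half-suc-odd c (odd ∘ ∣m∣n⇒∣m+n (∣-refl {2}))) ⟩
  1 + (1 + c / 2) ≡⟨ cong suc (m/n≡1+[m∸n]/n {2 + c} (s≤s (s≤s z≤n))) ⟨
  1 + (2 + c) / 2 ∎
  where open ≡-Reasoning

fill-emptyS : (C : Config s t) (j : Fin t) (i : Fin s) →
  emptyS C ≡ isZero (C (sv i)) + emptyS (step C (tv j) (sv i))
fill-emptyS C j i = ΣFin-update _ _ i (isZero (C (sv i)))
  (begin
    isZero (C (sv i))                                       ≡⟨ +-identityʳ _ ⟨
    isZero (C (sv i)) + isZero (suc (C (sv i)))             ≡⟨ cong (λ c → _ + isZero c) (step-target C (tv j) (sv i) (λ ())) ⟨
    isZero (C (sv i)) + isZero (step C (tv j) (sv i) (sv i)) ∎)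
  (λ i′ i′≢i → cong isZero (sym (step-other C (tv j) (sv i) (sv i′) (λ ()) (sv-≢ i′≢i))))
  where open ≡-Reasoning

fill-empty-emptyS : (C : Config s t) (j : Fin t) (i : Fin s) → C (sv i) ≡ 0 →
  emptyS C ≡ suc (emptyS (step C (tv j) (sv i)))
fill-empty-emptyS C j i Ci≡0 =
  trans (fill-emptyS C j i) (cong (λ c → isZero c + emptyS (step C (tv j) (sv i))) Ci≡0)

fill-pebbled-emptyS : (C : Config s t) (j : Fin t) (i : Fin s) {c : ℕ} → C (sv i) ≡ suc c →
  emptyS (step C (tv j) (sv i)) ≡ emptyS C
fill-pebbled-emptyS C j i Ci≡ =
  sym (trans (fill-emptyS C j i) (cong (λ m → isZero m + emptyS (step C (tv j) (sv i))) Ci≡))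

fill-pairsT : (C : Config s t) (j : Fin t) (i : Fin s) → 2 ≤ C (tv j) →
  pairsT C ≡ suc (pairsT (step C (tv j) (sv i)))
fill-pairsT C j i 2≤Cj = ΣFin-update _ _ j 1
  (trans (m/n≡1+[m∸n]/n 2≤Cj) (cong (λ c → suc (c / 2)) (sym (step-source C (tv j) (sv i)))))
  (λ j′ j′≢j → cong (_/ 2) (sym (step-other C (tv j) (sv i) (tv j′) (tv-≢ j′≢j) (λ ()))))

spill-emptyS : (C : Config s t) (i : Fin s) (j : Fin t) → C (sv i) ≡ 2 →
  emptyS (step C (sv i) (tv j)) ≡ suc (emptyS C)
spill-emptyS C i j Ci≡2 = ΣFin-update _ _ i 1
  (begin
    isZero (step C (sv i) (tv j) (sv i)) ≡⟨ cong isZero (step-source C (sv i) (tv j)) ⟩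
    isZero (C (sv i) ∸ 2)                ≡⟨ cong (λ c → isZero (c ∸ 2)) Ci≡2 ⟩
    1                                    ≡⟨ cong (λ c → 1 + isZero c) Ci≡2 ⟨
    1 + isZero (C (sv i))                ∎)
  (λ i′ i′≢i → cong isZero (step-other C (sv i) (tv j) (sv i′) (sv-≢ i′≢i) (λ ())))
  where open ≡-Reasoning

spill-pairsT : (C : Config s t) (i : Fin s) (j : Fin t) → Odd (C (tv j)) →
  pairsT (step C (sv i) (tv j)) ≡ suc (pairsT C)
spill-pairsT C i j oddCj = ΣFin-update _ _ j 1
  (trans (cong (_/ 2) (step-target C (sv i) (tv j) (λ ()))) (half-suc-odd _ oddCj))
  (λ j′ j′≢j → cong (_/ 2) (step-other C (sv i) (tv j) (tv j′) (λ ()) (tv-≢ j′≢j)))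

nonTrivial-except : (C : Config s t) (p : Fin s) → C root ≡ 0 → C (sv p) ≤ 1 →
  (∀ i → ¬ i ≡ p → C (sv i) ≤ 1) → NonTrivial C
nonTrivial-except {s} C p root≡0 p≤1 others = atMostOne , root≡0
  where
  atMostOne : (i : Fin s) → C (sv i) ≤ 1
  atMostOne i with i ≟F p
  ... | yes refl = p≤1
  ... | no i≢p = others i i≢p

fill-nonTrivial : (C : Config s t) (j : Fin t) (i : Fin s) → NonTrivial C →
  C (sv i) ≡ 0 → NonTrivial (step C (tv j) (sv i))
fill-nonTrivial C j i (atMostOne , root≡0) Ci≡0 = nonTrivial-except (step C (tv j) (sv i)) i
  (trans (step-other C (tv j) (sv i) root (λ ()) (λ ())) root≡0)
  (≤-reflexive (trans (step-target C (tv j) (sv i) (λ ())) (cong suc Ci≡0)))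
  (λ i′ i′≢i → subst (_≤ 1) (sym (step-other C (tv j) (sv i) (sv i′) (λ ()) (sv-≢ i′≢i)))
                     (atMostOne i′))

spill-nonTrivial : (C : Config s t) (i : Fin s) (j : Fin t) → C root ≡ 0 → C (sv i) ≡ 2 →
  (∀ i′ → ¬ i′ ≡ i → C (sv i′) ≤ 1) → NonTrivial (step C (sv i) (tv j))
spill-nonTrivial C i j root≡0 Ci≡2 others = nonTrivial-except (step C (sv i) (tv j)) i
  (trans (step-other C (sv i) (tv j) root (λ ()) (λ ())) root≡0)
  (subst (_≤ 1) (sym (trans (step-source C (sv i) (tv j)) (cong (_∸ 2) Ci≡2))) z≤n)
  (λ i′ i′≢i → subst (_≤ 1) (sym (step-other C (sv i) (tv j) (sv i′) (sv-≢ i′≢i) (λ ())))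
                     (others i′ i′≢i))

emptySVertex : (C : Config s t) → 1 ≤ emptyS C → Σ (Fin s) λ i → C (sv i) ≡ 0
emptySVertex C 1≤k =
  let (i , 1≤ind) = ΣFin-positive _ 1≤k in i , isZero-positive (C (sv i)) 1≤ind

heavyTVertex : (C : Config s t) → 1 ≤ pairsT C → Σ (Fin t) λ j → 2 ≤ C (tv j)
heavyTVertex C 1≤CT =
  let (j , 1≤half) = ΣFin-positive _ 1≤CT in j , half-positive (C (tv j)) 1≤half

doubledSWins : (H : SimpleGraph s) (C : Config s t) (i : Fin s) → 2 ≤ C (sv i) →
  MoverWins H C
doubledSWins H C i 2≤Ci = moverMove (sv i) root (tt , 2≤Ci) (rootPebbled (s≤s z≤n))

double-suc : (m : ℕ) → suc m + suc m ≡ suc (suc (m + m))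
double-suc m = cong suc (+-suc m m)

mutual
  -- Mover moves a pair from T onto a pebble-free S-vertex,
  -- leaving k = 2n and C_T ≥ k + 1 with Defender to move.
  oddDeficitWins : (H : SimpleGraph s) (n : ℕ) (C : Config s t) → NonTrivial C →
    emptyS C ≡ suc (n + n) → 2 + (n + n) ≤ pairsT C → MoverWins H C
  oddDeficitWins H n C nt k≡ 2+2n≤CT
    with emptySVertex C (subst (1 ≤_) (sym k≡) (s≤s z≤n))
       | heavyTVertex C (≤-trans (s≤s z≤n) 2+2n≤CT)
  ... | i , Ci≡0 | j , 2≤Cj =
    moverMove (tv j) (sv i) (tt , 2≤Cj)
      (evenDeficitDefenderLoses H n (step C (tv j) (sv i)) j i
        (fill-nonTrivial C j i nt Ci≡0)
        (suc-injective (trans (sym (fill-empty-emptyS C j i Ci≡0)) k≡))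
        (≤-pred (subst (2 + (n + n) ≤_) (fill-pairsT C j i 2≤Cj) 2+2n≤CT)))

  -- Defender to move after a Mover move T → S, with k = 2n and C_T ≥ k + 1.
  -- The root is empty and S-vertices hold at most one pebble, so Defender
  -- can only move a pair from T onto S (and some T-vertex holds a pair).
  evenDeficitDefenderLoses : (H : SimpleGraph s) (n : ℕ) (C : Config s t)
    (j : Fin t) (i : Fin s) → NonTrivial C → emptyS C ≡ n + n →
    suc (n + n) ≤ pairsT C → DefenderLoses H C (tv j) (sv i)
  evenDeficitDefenderLoses H n C j i nt@(atMostOne , root≡0) k≡ 1+2n≤CT
    with heavyTVertex C (≤-trans (s≤s z≤n) 1+2n≤CT)
  ... | b , 2≤Cb = allReplies (tv b , sv i , (tt , 2≤Cb) , λ { (() , _) }) reply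
    where
    reply : (x y : Vtx _ _) → LegalMove H C x y → ¬ (x ≡ sv i × y ≡ tv j) →
            MoverWins H (step C x y)
    reply root _ (_ , 2≤C) _ = ⊥-elim (<⇒≱ (s≤s z≤n) (subst (2 ≤_) root≡0 2≤C))
    reply (sv i′) _ (_ , 2≤C) _ = ⊥-elim (<⇒≱ (s≤s (atMostOne i′)) 2≤C)
    reply (tv _) root (() , _) _
    reply (tv _) (tv _) (() , _) _
    reply (tv b′) (sv i′) (_ , 2≤Cb′) _ with C (sv i′) in Ci′≡
    ... | suc _ = doubledSWins H _ i′
          (subst (2 ≤_) (sym (trans (step-target C (tv b′) (sv i′) (λ ())) (cong suc Ci′≡)))
                 (s≤s (s≤s z≤n)))
    ... | zero = fillEmptyWins H n C b′ i′ nt k≡ 1+2n≤CT Ci′≡ 2≤Cb′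

  -- Defender filled a pebble-free S-vertex from T while k = 2n and
  -- C_T ≥ k + 1: now k = 2n − 1 and C_T ≥ k + 1.  (For n = 0 there was no
  -- pebble-free S-vertex to fill.)
  fillEmptyWins : (H : SimpleGraph s) (n : ℕ) (C : Config s t) (b : Fin t) (i : Fin s) →
    NonTrivial C → emptyS C ≡ n + n → suc (n + n) ≤ pairsT C → C (sv i) ≡ 0 →
    2 ≤ C (tv b) → MoverWins H (step C (tv b) (sv i))
  fillEmptyWins H zero C b i nt k≡ _ Ci≡0 _ =
    ⊥-elim (1+n≢0 (trans (sym (fill-empty-emptyS C b i Ci≡0)) k≡))
  fillEmptyWins H (suc m) C b i nt k≡ 1+2n≤CT Ci≡0 2≤Cb =
    oddDeficitWins H m (step C (tv b) (sv i))
      (fill-nonTrivial C b i nt Ci≡0)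
      (suc-injective (trans (sym (fill-empty-emptyS C b i Ci≡0)) (trans k≡ (double-suc m))))
      (subst (_≤ pairsT (step C (tv b) (sv i))) (double-suc m)
        (≤-pred (subst (suc (suc m + suc m) ≤_) (fill-pairsT C b i 2≤Cb) 1+2n≤CT)))

adjacent-≢ : (H : SimpleGraph s) {v w : Fin s} → Adj H v w → ¬ sv {t = t} v ≡ sv w
adjacent-≢ H v~w refl = irrefl H v~w

doubledVertexDefenderLoses : (H : SimpleGraph s) (q : ℕ) (C : Config s t)
  (x : Fin t) (v : Fin s) → C root ≡ 0 → C (sv v) ≡ 2 →
  (∀ i → ¬ i ≡ v → C (sv i) ≤ 1) → (∀ w → Adj H v w → 1 ≤ C (sv w)) →
  emptyS C ≡ q + q → pairsT C ≡ suc (q + q) →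
  (∀ j → ¬ j ≡ x → Odd (C (tv j))) → DefenderLoses H C (tv x) (sv v)
doubledVertexDefenderLoses H q C x v root≡0 Cv≡2 others nbrs k≡ CT≡ odd =
  allReplies (sv v , root , (tt , 2≤Cv) , λ { (_ , ()) }) reply
  where
  2≤Cv : 2 ≤ C (sv v)
  2≤Cv = ≤-reflexive (sym Cv≡2)

  -- Defender moves v's two pebbles: to the root, onto a pebbled neighbour,
  -- or onto an odd T-vertex (x is excluded as it would undo Mover's move).
  fromV : (y : Vtx _ _) → LegalMove H C (sv v) y → ¬ (sv v ≡ sv v × y ≡ tv x) →
          MoverWins H (step C (sv v) y)
  fromV root _ _ = rootPebbled (s≤s z≤n)
  fromV (sv w) (v~w , _) _ = doubledSWins H _ w
    (≤-trans (s≤s (nbrs w v~w))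
             (≤-reflexive (sym (step-target C (sv v) (sv w) (adjacent-≢ H v~w)))))
  fromV (tv y) _ banned = oddDeficitWins H q (step C (sv v) (tv y))
    (spill-nonTrivial C v y root≡0 Cv≡2 others)
    (trans (spill-emptyS C v y Cv≡2) (cong suc k≡))
    (≤-reflexive (sym (trans (spill-pairsT C v y (odd y y≢x)) (cong suc CT≡))))
    where
    y≢x : ¬ y ≡ x
    y≢x y≡x = banned (refl , cong tv y≡x)

  -- Moves from T leave v with two pebbles; other S-vertices and the root
  -- cannot move.
  reply : (a b : Vtx _ _) → LegalMove H C a b → ¬ (a ≡ sv v × b ≡ tv x) →
          MoverWins H (step C a b)
  reply root _ (_ , 2≤C) _ = ⊥-elim (<⇒≱ (s≤s z≤n) (subst (2 ≤_) root≡0 2≤C))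
  reply (tv j) b _ _ =
    doubledSWins H _ v (≤-trans 2≤Cv (step-nonsource-≥ C (tv j) b (sv v) (λ ())))
  reply (sv i) b legal banned with i ≟F v
  ... | yes refl = fromV b legal banned
  ... | no i≢v = ⊥-elim (<⇒≱ (s≤s (others i i≢v)) (proj₂ legal))

boundary-counts : (C : Config s t) → Even (pebbleFreeS C) → C-T C ≡ pebbleFreeS C + 2 →
  Σ ℕ λ q → emptyS C ≡ q + q × pairsT C ≡ 2 + (q + q)
boundary-counts C (divides q k≡q*2) CT≡k+2 = q , k≡ , CT≡
  where
  open ≡-Reasoning
  k≡ : emptyS C ≡ q + q
  k≡ = begin
    emptyS C      ≡⟨ pebbleFreeS≡emptyS C ⟨
    pebbleFreeS C ≡⟨ k≡q*2 ⟩
    q * 2         ≡⟨ trans (*-comm q 2) (cong (q +_) (+-identityʳ q)) ⟩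
    q + q         ∎
  CT≡ : pairsT C ≡ 2 + (q + q)
  CT≡ = begin
    pairsT C          ≡⟨ C-T≡pairsT C ⟨
    C-T C             ≡⟨ CT≡k+2 ⟩
    pebbleFreeS C + 2 ≡⟨ cong (_+ 2) (trans (pebbleFreeS≡emptyS C) k≡) ⟩
    (q + q) + 2       ≡⟨ +-comm (q + q) 2 ⟩
    2 + (q + q)       ∎

lemma3p11 : (s t : ℕ) → 1 ≤ s → 2 ≤ t → (H : SimpleGraph s) →
    (C : Config s t) → Boundary C →
    (Σ (Fin s) λ v → 1 ≤ C (sv v) × ((w : Fin s) → Adj H v w → 1 ≤ C (sv w))) →
    MoverWins H C
lemma3p11 s t _ _ H C ((atMostOne , root≡0) , kEven , CT≡k+2 , x , _ , 2≤Cx , odd)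
          (v , 1≤Cv , nbrs) with boundary-counts C kEven CT≡k+2
... | q , k≡ , CT≡ =
  moverMove (tv x) (sv v) (tt , 2≤Cx)
    (doubledVertexDefenderLoses H q C′ x v
      (trans (elsewhere root (λ ()) (λ ())) root≡0)
      (trans (step-target C (tv x) (sv v) (λ ())) (cong suc Cv≡1))
      (λ i i≢v → subst (_≤ 1) (sym (elsewhere (sv i) (λ ()) (sv-≢ i≢v))) (atMostOne i))
      (λ w v~w → ≤-trans (nbrs w v~w) (step-nonsource-≥ C (tv x) (sv v) (sv w) (λ ())))
      (trans (fill-pebbled-emptyS C x v Cv≡1) k≡)
      (suc-injective (trans (sym (fill-pairsT C x v 2≤Cx)) CT≡))
      (λ j j≢x → subst Odd (sym (elsewhere (tv j) (tv-≢ j≢x) (λ ()))) (odd j j≢x)))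
  where
  C′ : Config s t
  C′ = step C (tv x) (sv v)
  elsewhere : (w : Vtx s t) → ¬ w ≡ tv x → ¬ w ≡ sv v → C′ w ≡ C w
  elsewhere = step-other C (tv x) (sv v)
  Cv≡1 : C (sv v) ≡ 1
  Cv≡1 = ≤-antisym (atMostOne v) 1≤Cv
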